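{- Let $G=(V,E)$ be a finite simple graph and $T$ a positive integer. For each zero forcing set $C$ corresponding to a zero forcing game in $\mathcal{Z}(G,T)$, there is a feasible solution $(s,x,y,z)$ of the Infection Model $\mathrm{IM}(G,T)$ such that $|C|=\sum_{v\in V}s_v$ and $z=\operatorname{pt}(G,C)\le T$. Here a feasible solution of $\mathrm{IM}(G,T)$ is $s\in\{0,1\}^V$, $x\in\{0,\ldots,T\}^V$, $y\in\{0,1\}^A$, $z\in\{0,\ldots,T\}$ satisfying (i) $s_v+\sum_{a=(u,v)\in A}y_a=1$ for all $v\in V$; (ii) $x_u-x_v+(T+1)y_a\le T$ for all $a=(u,v)\in A$; (iii) $x_w-x_v+(T+1)y_a\le T$ for all $a=(u,v)\in A$, $w\in N(u)\setminus\{v\}$; (iv) $x_v\le z$ for all $v\in V$.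
   Context: $N(u)$ denotes the neighborhood of $u$; $A$ contains both arcs $(u,v),(v,u)$ for each edge $\{u,v\}$. Standard zero forcing rule: a filled vertex $u$ forces a non-filled vertex $v$ if $v$ is the only non-filled neighbor of $u$. A zero forcing game with initial set $C$ consists of sets $C^{(t)}$, $C^{[t]}$ with $C=C^{(0)}=C^{[0]}$, $C^{[t]}=C^{[t-1]}\cup C^{(t)}$, every vertex in exactly one $C^{(t)}$, and each $v\in C^{(t)}$, $t\ge 1$, forced by exactly one neighbor $u$ such that $u$ and all neighbors of $u$ except $v$ are in $C^{[t-1]}$ (not all available forces need be applied at each step). $C$ is a zero forcing set if all vertices eventually become filled. $\mathcal{Z}(G,T)$ is the family of zero forcing games whose initial set is a zero forcing set and which use at most $T$ time steps. $\operatorname{pt}(G,C)$ is the number of time steps needed to fill all vertices from $C$ when at each time step all possible forces are applied simultaneously. -}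

module Defs where

open import Data.Nat using (ℕ; zero; suc; _+_; _*_; _≤_; _<_)
open import Data.Bool using (Bool; true; false; _∧_; _∨_; not; if_then_else_)
open import Data.Fin using (Fin; _≟_)
import Data.Fin as F
open import Data.Product using (Σ; _×_; _,_)
open import Relation.Nullary using (¬_; does)
open import Relation.Binary.PropositionalEquality using (_≡_; _≢_)

record Graph (n : ℕ) : Set where
  field
    adj    : Fin n → Fin n → Bool
    sym    : ∀ u v → adj u v ≡ adj v u
    irrefl : ∀ v → adj v v ≡ false
open Graph public

sumF : ∀ {n} → (Fin n → ℕ) → ℕ
sumF {zero}  f = 0
sumF {suc n} f = f F.zero + sumF (λ i → f (F.suc i))

anyF : ∀ {n} → (Fin n → Bool) → Bool
anyF {zero}  f = false
anyF {suc n} f = f F.zero ∨ anyF (λ i → f (F.suc i))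

allF : ∀ {n} → (Fin n → Bool) → Bool
allF {zero}  f = true
allF {suc n} f = f F.zero ∧ allF (λ i → f (F.suc i))

VSet : ℕ → Set
VSet n = Fin n → Bool

card : ∀ {n} → VSet n → ℕ
card S = sumF (λ v → if S v then 1 else 0)

Full : ∀ {n} → VSet n → Set
Full S = ∀ v → S v ≡ true

-- One step of the zero forcing rule with ALL possible forces applied
-- simultaneously: v becomes filled if some filled u adjacent to v has all
-- its neighbours other than v filled.
step : ∀ {n} → Graph n → VSet n → VSet n
step G S v =
  S v ∨ anyF (λ u → S u ∧ adj G u v ∧
                 allF (λ w → does (w ≟ v) ∨ not (adj G u w) ∨ S w))

fill : ∀ {n} → Graph n → VSet n → ℕ → VSet n
fill G C zero    = C
fill G C (suc t) = step G (fill G C t)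

IsPropTime : ∀ {n} → Graph n → VSet n → ℕ → Set
IsPropTime G C t = Full (fill G C t) × (∀ t' → t' < t → ¬ Full (fill G C t'))

-- A zero forcing game using at most T time steps (a member of Z(G,T)).
-- τ v = the unique t with v ∈ C^(t); each v with τ v ≥ 1 is forced by exactly
-- one chosen neighbour  forcer v  such that the forcer and all of its
-- neighbours except v lie in C^[τ v - 1].
record ZFGame {n : ℕ} (G : Graph n) (T : ℕ) : Set where
  field
    τ       : Fin n → ℕ
    τ≤T     : ∀ v → τ v ≤ T
    forcer  : ∀ v → 1 ≤ τ v → Fin n
    forcer-adj    : ∀ v (h : 1 ≤ τ v) → adj G (forcer v h) v ≡ true
    forcer-filled : ∀ v (h : 1 ≤ τ v) → τ (forcer v h) < τ v
    forcer-others : ∀ v (h : 1 ≤ τ v) (w : Fin n) →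
                    adj G (forcer v h) w ≡ true → w ≢ v → τ w < τ v
open ZFGame public

initialSet : ∀ {n} {G : Graph n} {T : ℕ} → ZFGame G T → VSet n
initialSet g v with τ g v
... | zero  = true
... | suc _ = false

-- Arc variables y are
-- given as y u v for the arc (u,v); only entries with adj u v ≡ true are
-- used.  Constraints (ii),(iii) are written with the x_v term moved to the
-- right-hand side (natural-number arithmetic).
record IMFeasible {n : ℕ} (G : Graph n) (T : ℕ)
       (s : Fin n → ℕ) (x : Fin n → ℕ) (y : Fin n → Fin n → ℕ) (z : ℕ) : Set where
  field
    s-bin  : ∀ v → s v ≤ 1
    x-rng  : ∀ v → x v ≤ T
    y-bin  : ∀ u v → y u v ≤ 1
    z-rng  : z ≤ T
    c-i    : ∀ v → s v + sumF (λ u → if adj G u v then y u v else 0) ≡ 1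
    c-ii   : ∀ u v → adj G u v ≡ true → x u + suc T * y u v ≤ T + x v
    c-iii  : ∀ u v w → adj G u v ≡ true → adj G u w ≡ true → w ≢ v →
             x w + suc T * y u v ≤ T + x v
    c-iv   : ∀ v → x v ≤ z

-- Applying all available forces at once is at least as fast as any zero forcing game,
-- so from the initial set C of a game in Z(G,T) every vertex is filled within T rounds. Take s = 1_C, x_v = the round in which v is first filled and
-- z = the first round in which all vertices are filled, i.e. pt(G,C); for each v ∉ C let
-- y select a single vertex u that forces v in round x_v. Then (i) holds since each vertex
-- is either initial or gets exactly one forcing arc, and (ii), (iii) are big-M constraints:
-- vacuous when y_a = 0 since x ≤ T, and when y_a = 1 they say that u and all its other
-- neighbours were filled strictly before v.

module Submission where

open import Defs hiding (sym)
open import Data.Bool using (Bool; true; false; _∧_; _∨_; not; if_then_else_)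
import Data.Bool as Bool
open import Data.Bool.Properties using (∨-zeroʳ)
open import Function using (_∘_)
open import Data.Fin using (Fin; _≟_)
import Data.Fin as F
open import Data.Fin.Properties using (any?)
open import Data.Maybe using (Maybe; just; nothing)
import Data.Maybe as Maybe
import Data.Maybe.Properties as Maybe
open import Data.Nat using (ℕ; zero; suc; _+_; _*_; _≤_; _<_; z≤n; s≤s)
open import Data.Nat.Properties
  using ( module ≤-Reasoning; ≤-refl; ≤-reflexive; ≤-trans; ≤-pred; m≤m+n; n≤0⇒n≡0; ≤∧≢⇒<
        ; +-comm; +-suc; +-monoˡ-≤; +-identityʳ; *-zeroʳ; *-identityʳ)
open import Data.Product using (Σ; ∃; _×_; _,_; proj₁; proj₂)
open import Data.Sum using (_⊎_; inj₁; inj₂)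
open import Relation.Nullary using (does; yes; no; contradiction)
open import Relation.Nullary.Decidable using (dec-true; dec-false; dec⇒maybe)
open import Relation.Binary.PropositionalEquality
  using (_≡_; _≢_; refl; sym; trans; cong; subst)

∨-trueˡ : ∀ {a} b → a ≡ true → a ∨ b ≡ true
∨-trueˡ b refl = refl

∨-trueʳ : ∀ a {b} → b ≡ true → a ∨ b ≡ true
∨-trueʳ a refl = ∨-zeroʳ a

∧-true : ∀ {a b} → a ≡ true → b ≡ true → a ∧ b ≡ true
∧-true refl refl = refl

∧-true⁻ : ∀ a {b} → a ∧ b ≡ true → a ≡ true × b ≡ true
∧-true⁻ true eq = refl , eq

anyF-intro : ∀ {n} (f : Fin n → Bool) i → f i ≡ true → anyF f ≡ true
anyF-intro f F.zero    fi = ∨-trueˡ _ fi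
anyF-intro f (F.suc i) fi = ∨-trueʳ (f F.zero) (anyF-intro (λ j → f (F.suc j)) i fi)

anyF-elim : ∀ {n} (f : Fin n → Bool) → anyF f ≡ true → ∃ λ i → f i ≡ true
anyF-elim {suc n} f eq with f F.zero in f0
... | true  = F.zero , f0
... | false with anyF-elim (λ j → f (F.suc j)) eq
...   | i , fi = F.suc i , fi

allF-intro : ∀ {n} (f : Fin n → Bool) → (∀ i → f i ≡ true) → allF f ≡ true
allF-intro {zero}  f all = refl
allF-intro {suc n} f all =
  ∧-true (all F.zero) (allF-intro (λ j → f (F.suc j)) (λ j → all (F.suc j)))

allF-elim : ∀ {n} (f : Fin n → Bool) → allF f ≡ true → ∀ i → f i ≡ true
allF-elim f eq F.zero    = proj₁ (∧-true⁻ (f F.zero) eq)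
allF-elim f eq (F.suc i) = allF-elim (λ j → f (F.suc j)) (proj₂ (∧-true⁻ (f F.zero) eq)) i

sumF-zero : ∀ {n} (f : Fin n → ℕ) → (∀ i → f i ≡ 0) → sumF f ≡ 0
sumF-zero {zero}  f f≡0 = refl
sumF-zero {suc n} f f≡0 rewrite f≡0 F.zero = sumF-zero (λ i → f (F.suc i)) (λ i → f≡0 (F.suc i))

sumF-single : ∀ {n} (f : Fin n → ℕ) j → (∀ i → i ≢ j → f i ≡ 0) → sumF f ≡ f j
sumF-single f F.zero f≡0
  rewrite sumF-zero (λ i → f (F.suc i)) (λ i → f≡0 (F.suc i) (λ ())) = +-identityʳ (f F.zero)
sumF-single f (F.suc j) f≡0 rewrite f≡0 F.zero (λ ()) =
  sumF-single (λ i → f (F.suc i)) j (λ i i≢j → f≡0 (F.suc i) (λ { refl → i≢j refl }))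

-- The least t ≤ k with p t; when there is none the result is k.
firstUpTo : (ℕ → Bool) → ℕ → ℕ
firstUpTo p zero    = 0
firstUpTo p (suc k) = if p 0 then 0 else suc (firstUpTo (λ t → p (suc t)) k)

firstUpTo-≤ : ∀ (p : ℕ → Bool) k → firstUpTo p k ≤ k
firstUpTo-≤ p zero    = z≤n
firstUpTo-≤ p (suc k) with p 0
... | true  = z≤n
... | false = s≤s (firstUpTo-≤ (λ t → p (suc t)) k)

firstUpTo-minimal : ∀ (p : ℕ → Bool) k {t} → p t ≡ true → firstUpTo p k ≤ t
firstUpTo-minimal p zero    pt = z≤n
firstUpTo-minimal p (suc k) {t} pt with p 0 in p0 | t
... | true  | _     = z≤n
... | false | zero  = contradiction (trans (sym p0) pt) λ ()
... | false | suc t = s≤s (firstUpTo-minimal (λ t → p (suc t)) k pt)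

firstUpTo-before : ∀ (p : ℕ → Bool) k {t} → t < firstUpTo p k → p t ≡ false
firstUpTo-before p (suc k) {t} lt with p 0 in p0 | t | lt
... | false | zero  | _        = p0
... | false | suc t | s≤s t<k = firstUpTo-before (λ t → p (suc t)) k t<k

firstUpTo-true : ∀ (p : ℕ → Bool) k {t} → p t ≡ true → t ≤ k → p (firstUpTo p k) ≡ true
firstUpTo-true p zero    {zero} pt _ = pt
firstUpTo-true p (suc k) {t} pt t≤k with p 0 in p0 | t | t≤k
... | true  | _     | _         = p0
... | false | zero  | _         = contradiction (trans (sym p0) pt) λ ()
... | false | suc t | s≤s t≤k′ = firstUpTo-true (λ t → p (suc t)) k pt t≤k′

if-then-else-zero : ∀ b {m} → m ≡ 0 → (if b then m else 0) ≡ 0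
if-then-else-zero true  m≡0 = m≡0
if-then-else-zero false _   = refl

indicator-≤1 : ∀ b → (if b then 1 else 0) ≤ 1
indicator-≤1 true  = ≤-refl
indicator-≤1 false = z≤n

pick : ∀ {n} → (Fin n → Bool) → Maybe (Fin n)
pick f = Maybe.map proj₁ (dec⇒maybe (any? (λ i → f i Bool.≟ true)))

pick-sound : ∀ {n} (f : Fin n → Bool) {i} → pick f ≡ just i → f i ≡ true
pick-sound f with any? (λ i → f i Bool.≟ true)
... | yes (i , fi) = λ { refl → fi }
... | no _         = λ ()

pick-complete : ∀ {n} (f : Fin n → Bool) {i} → f i ≡ true → ∃ λ j → pick f ≡ just j
pick-complete f {i} fi with any? (λ i → f i Bool.≟ true)
... | yes (j , _) = j , refl
... | no ¬∃      = contradiction (i , fi) ¬∃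

module _ {n} (G : Graph n) where

  canForce : VSet n → Fin n → Fin n → Bool
  canForce S u v = S u ∧ adj G u v ∧ allF (λ w → does (w ≟ v) ∨ not (adj G u w) ∨ S w)

  OthersFilled : VSet n → Fin n → Fin n → Set
  OthersFilled S u v = ∀ w → adj G u w ≡ true → w ≢ v → S w ≡ true

  canForce-intro : ∀ S {u v} → S u ≡ true → adj G u v ≡ true → OthersFilled S u v →
                   canForce S u v ≡ true
  canForce-intro S {u} {v} Su uv others = ∧-true Su (∧-true uv (allF-intro _ guard))
    where
    guard : ∀ w → (does (w ≟ v) ∨ not (adj G u w) ∨ S w) ≡ true
    guard w with w ≟ v | adj G u w in uw
    ... | yes _   | _     = refl
    ... | no _    | false = refl
    ... | no w≢v  | true  = others w uw w≢v

  canForce-elim : ∀ S {u v} → canForce S u v ≡ true →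
                  S u ≡ true × adj G u v ≡ true × OthersFilled S u v
  canForce-elim S {u} {v} eq with ∧-true⁻ (S u) eq
  ... | Su , rest with ∧-true⁻ (adj G u v) rest
  ...   | uv , guards = Su , uv , others
    where
    others : OthersFilled S u v
    others w uw w≢v with allF-elim _ guards w
    ... | guard with w ≟ v
    ...   | yes w≡v = contradiction w≡v w≢v
    ...   | no _ rewrite uw = guard

  step-kept : ∀ S v → S v ≡ true → step G S v ≡ true
  step-kept S v Sv = ∨-trueˡ _ Sv

  step-forced : ∀ S u v → canForce S u v ≡ true → step G S v ≡ true
  step-forced S u v uv = ∨-trueʳ (S v) (anyF-intro _ u uv)

  step-new : ∀ S v → step G S v ≡ true → S v ≡ false → ∃ λ u → canForce S u v ≡ true
  step-new S v new Sv rewrite Sv = anyF-elim _ new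

module _ {n} {G : Graph n} {T} (g : ZFGame G T) where

  private
    C : VSet n
    C = initialSet g

  game-filled : ∀ t v → τ g v ≤ t → fill G C t v ≡ true
  game-filled zero v τv≤0 with τ g v | n≤0⇒n≡0 τv≤0
  ... | zero | refl = refl
  game-filled (suc t) v τv≤1+t with τ g v Data.Nat.≟ suc t
  ... | no τv≢1+t = step-kept G (fill G C t) v (game-filled t v (≤-pred (≤∧≢⇒< τv≤1+t τv≢1+t)))
  ... | yes τv≡1+t =
    step-forced G (fill G C t) u v
      (canForce-intro G (fill G C t) (before (forcer-filled g v forced)) (forcer-adj g v forced) others)
    where
    forced : 1 ≤ τ g v
    forced = subst (1 ≤_) (sym τv≡1+t) (s≤s z≤n)
    u = forcer g v forced
    before : ∀ {w} → τ g w < τ g v → fill G C t w ≡ true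
    before {w} lt = game-filled t w (≤-pred (subst (τ g w <_) τv≡1+t lt))
    others : OthersFilled G (fill G C t) u v
    others w uw w≢v = before (forcer-others g v forced w uw w≢v)

  game-full-by-T : Full (fill G C T)
  game-full-by-T v = game-filled T v (τ≤T g v)

big-M-inactive : ∀ T {a} b → a ≤ T → a + suc T * 0 ≤ T + b
big-M-inactive T {a} b a≤T rewrite *-zeroʳ T | +-identityʳ a = ≤-trans a≤T (m≤m+n T b)

big-M-active : ∀ T {a b} → a < b → a + suc T * 1 ≤ T + b
big-M-active T {a} {b} a<b rewrite *-identityʳ T = begin
  a + suc T ≡⟨ +-suc a T ⟩
  suc a + T ≤⟨ +-monoˡ-≤ T a<b ⟩
  b + T     ≡⟨ +-comm b T ⟩
  T + b     ∎
  where open ≤-Reasoning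

module InfectionModel {n} (G : Graph n) (T : ℕ) (C : VSet n) (full : Full (fill G C T)) where

  s : Fin n → ℕ
  s v = if C v then 1 else 0

  filledAt : Fin n → ℕ → Bool
  filledAt v t = fill G C t v

  allFilledAt : ℕ → Bool
  allFilledAt t = allF (fill G C t)

  x : Fin n → ℕ
  x v = firstUpTo (filledAt v) T

  z : ℕ
  z = firstUpTo allFilledAt T

  forcerAfter : ℕ → Fin n → Maybe (Fin n)
  forcerAfter zero    v = nothing
  forcerAfter (suc t) v = pick (λ u → canForce G (fill G C t) u v)

  forcerOf : Fin n → Maybe (Fin n)
  forcerOf v = forcerAfter (x v) v

  y : Fin n → Fin n → ℕ
  y u v = if does (Maybe.≡-dec _≟_ (forcerOf v) (just u)) then 1 else 0

  x≤T : ∀ v → x v ≤ T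
  x≤T v = firstUpTo-≤ (filledAt v) T

  x-filled : ∀ v → fill G C (x v) v ≡ true
  x-filled v = firstUpTo-true (filledAt v) T (full v) ≤-refl

  x-minimal : ∀ {t} v → fill G C t v ≡ true → x v ≤ t
  x-minimal v = firstUpTo-minimal (filledAt v) T

  x-before : ∀ {t} v → t < x v → fill G C t v ≡ false
  x-before v = firstUpTo-before (filledAt v) T

  z≤T : z ≤ T
  z≤T = firstUpTo-≤ allFilledAt T

  z-full : Full (fill G C z)
  z-full = allF-elim _ (firstUpTo-true allFilledAt T (allF-intro _ full) ≤-refl)

  z-propTime : IsPropTime G C z
  z-propTime = z-full , λ t t<z full-t →
    contradiction (trans (sym (firstUpTo-before allFilledAt T t<z)) (allF-intro _ full-t)) λ ()

  x≤z : ∀ v → x v ≤ z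
  x≤z v = x-minimal v (z-full v)

  y-forcer : ∀ {u v} → forcerOf v ≡ just u → y u v ≡ 1
  y-forcer {u} {v} f rewrite dec-true (Maybe.≡-dec _≟_ (forcerOf v) (just u)) f = refl

  y-other : ∀ {u v} → forcerOf v ≢ just u → y u v ≡ 0
  y-other {u} {v} ¬f rewrite dec-false (Maybe.≡-dec _≟_ (forcerOf v) (just u)) ¬f = refl

  forcerAfter-sound : ∀ k {u v} → forcerAfter k v ≡ just u →
                      ∃ λ t → k ≡ suc t × canForce G (fill G C t) u v ≡ true
  forcerAfter-sound (suc t) {v = v} f = t , refl , pick-sound (λ u → canForce G (fill G C t) u v) f

  initial-or-forcedAt : ∀ k v → x v ≡ k →
    (C v ≡ true × forcerAfter k v ≡ nothing) ⊎ (C v ≡ false × ∃ λ u → forcerAfter k v ≡ just u)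
  initial-or-forcedAt zero v xv≡0 = inj₁ (subst (λ t → filledAt v t ≡ true) xv≡0 (x-filled v) , refl)
  initial-or-forcedAt (suc t) v xv≡1+t
    with step-new G (fill G C t) v (subst (λ t → filledAt v t ≡ true) xv≡1+t (x-filled v))
                      (x-before v (≤-reflexive (sym xv≡1+t)))
  ... | u , forcing =
    inj₂ (x-before v (≤-trans (s≤s z≤n) (≤-reflexive (sym xv≡1+t))) , pick-complete _ forcing)

  initial-or-forced : ∀ v →
    (C v ≡ true × forcerOf v ≡ nothing) ⊎ (C v ≡ false × ∃ λ u → forcerOf v ≡ just u)
  initial-or-forced v = initial-or-forcedAt (x v) v refl

  forcerOf-sound : ∀ {u v} → forcerOf v ≡ just u →
                   ∃ λ t → x v ≡ suc t × canForce G (fill G C t) u v ≡ true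
  forcerOf-sound {v = v} = forcerAfter-sound (x v)

  forcer-adjacent : ∀ {u v} → forcerOf v ≡ just u → adj G u v ≡ true
  forcer-adjacent f with forcerOf-sound f
  ... | t , _ , forcing = proj₁ (proj₂ (canForce-elim G (fill G C t) forcing))

  forcer-earlier : ∀ {u v} → forcerOf v ≡ just u →
                   x u < x v × (∀ w → adj G u w ≡ true → w ≢ v → x w < x v)
  forcer-earlier {u} {v} f with forcerOf-sound f
  ... | t , xv≡1+t , forcing =
    before (x-minimal u (proj₁ rule)) ,
    λ w uw w≢v → before (x-minimal w (proj₂ (proj₂ rule) w uw w≢v))
    where
    rule = canForce-elim G (fill G C t) forcing
    before : ∀ {a} → a ≤ t → a < x v
    before a≤t = subst (_ <_) (sym xv≡1+t) (s≤s a≤t)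

  covered-exactly-once : ∀ v → s v + sumF (λ u → if adj G u v then y u v else 0) ≡ 1
  covered-exactly-once v with initial-or-forced v
  ... | inj₁ (Cv , none) rewrite Cv =
    cong suc (sumF-zero _ λ u →
      if-then-else-zero (adj G u v) (y-other {u} λ f → contradiction (trans (sym none) f) λ ()))
  ... | inj₂ (Cv , u , f) rewrite Cv = trans (sumF-single _ u others) forcer-weight
    where
    others : ∀ u′ → u′ ≢ u → (if adj G u′ v then y u′ v else 0) ≡ 0
    others u′ u′≢u =
      if-then-else-zero (adj G u′ v) (y-other λ f′ → u′≢u (Maybe.just-injective (trans (sym f′) f)))
    forcer-weight : (if adj G u v then y u v else 0) ≡ 1
    forcer-weight rewrite forcer-adjacent f = y-forcer f

  arc-constraint : ∀ u v w → x w ≤ T → (forcerOf v ≡ just u → x w < x v) →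
                   x w + suc T * y u v ≤ T + x v
  arc-constraint u v w xw≤T earlier with Maybe.≡-dec _≟_ (forcerOf v) (just u)
  ... | yes f = big-M-active T (earlier f)
  ... | no _  = big-M-inactive T (x v) xw≤T

  feasible : IMFeasible G T s x y z
  feasible = record
    { s-bin = λ v → indicator-≤1 (C v)
    ; x-rng = x≤T
    ; y-bin = λ u v → indicator-≤1 (does (Maybe.≡-dec _≟_ (forcerOf v) (just u)))
    ; z-rng = z≤T
    ; c-i   = covered-exactly-once
    ; c-ii  = λ u v _ → arc-constraint u v u (x≤T u) (proj₁ ∘ forcer-earlier)
    ; c-iii = λ u v w _ uw w≢v →
                arc-constraint u v w (x≤T w) (λ f → proj₂ (forcer-earlier f) w uw w≢v)
    ; c-iv  = x≤z
    }

theorem3p2 : ∀ {n : ℕ} (G : Graph n) (T : ℕ) → 1 ≤ T → (g : ZFGame G T) →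
    Σ (Fin n → ℕ) λ s → Σ (Fin n → ℕ) λ x → Σ (Fin n → Fin n → ℕ) λ y → Σ ℕ λ z →
      IMFeasible G T s x y z × card (initialSet g) ≡ sumF s ×
      IsPropTime G (initialSet g) z × z ≤ T
theorem3p2 G T _ g = s , x , y , z , feasible , refl , z-propTime , z≤T
  where open InfectionModel G T (initialSet g) (game-full-by-T g)
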